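{- Let $k\geq 2$ be an integer, let $H$ be a graph and $\mathcal{C}_H$ a collection of pairwise disjoint non-empty subsets of $V(H)$ such that for each $D\in\mathcal{C}_H$ we have $\overline{e}_H(D)\leq (k-1)|D|+1$ and $\deg_H(v)\geq k$ for all $v\in D$. Let $w\in V_{\leq k-1}(H)$ with $\overline{e}_H(\operatorname{sh}_H(w))<(k-1)|\operatorname{sh}_H(w)|$. Then $$\sum_{\substack{s\in \operatorname{sh}_H(w)\\ \deg_H(s)\leq k-1}}(k-\deg_H(s))\leq 2\big((k-1)|\operatorname{sh}_H(w)|-\overline{e}_H(\operatorname{sh}_H(w))\big).$$
   Context: Graphs are finite and simple. $V_{\leq k-1}(H)$ is the set of vertices of $H$ of degree at most $k-1$. For $X\subseteq V(H)$, $\overline{e}_H(X)$ is the number of edges of $H$ incident with at least one vertex of $X$, and $H-X$ is the graph obtained by deleting $X$. A vertex $v$ is adjacent to a set $X$ if it is adjacent to some vertex of $X$. For $w\in V_{\leq k-1}(H)$, the shadow $\operatorname{sh}_H(w)$ (with respect to $\mathcal{C}_H$) is the unique minimal (under inclusion) set $Y\subseteq V(H)$ such that: (I) $w\in Y$; (II) for each $D\in\mathcal{C}_H$, either $D\subseteq Y$ or $D\cap Y=\emptyset$; (III) if $v\in V(H)\setminus Y$ is adjacent to a vertex in $Y$, then $\deg_{H-Y}(v)\geq k$; (IV) if $D\in\mathcal{C}_H$ is adjacent to a vertex in $Y$, then $D\subseteq Y$. -}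

module Defs where

open import Data.Nat using (ℕ; zero; suc; _+_; _*_; _∸_; _≤_; _<_)
open import Data.Bool using (Bool; true; false; _∧_; _∨_; if_then_else_)
open import Data.Fin using (Fin; zero; suc; toℕ)
open import Data.Fin.Subset using (Subset; _∈_; _∉_; _⊆_; ∣_∣)
open import Data.Vec using (lookup)
open import Data.Product using (Σ; _×_; ∃; ∃-syntax; _,_)
open import Data.Sum using (_⊎_)
open import Data.Empty using (⊥)
open import Relation.Binary.PropositionalEquality using (_≡_; _≢_)
open import Relation.Nullary using (¬_)
open import Relation.Nullary.Decidable using (⌊_⌋)
import Data.Nat as ℕ

record Graph (n : ℕ) : Set where
  field
    adj     : Fin n → Fin n → Bool
    symm    : ∀ u v → adj u v ≡ adj v u
    irrefl  : ∀ v → adj v v ≡ false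
open Graph public

Adj : ∀ {n} → Graph n → Fin n → Fin n → Set
Adj H u v = adj H u v ≡ true

count : ∀ {n} → (Fin n → Bool) → ℕ
count {zero}  p = 0
count {suc n} p = (if p zero then 1 else 0) + count (λ i → p (suc i))

sumF : ∀ {n} → (Fin n → ℕ) → ℕ
sumF {zero}  f = 0
sumF {suc n} f = f zero + sumF (λ i → f (suc i))

mem : ∀ {n} → Subset n → Fin n → Bool
mem X u = lookup X u

deg : ∀ {n} → Graph n → Fin n → ℕ
deg H v = count (λ u → adj H v u)

degMinus : ∀ {n} → Graph n → Subset n → Fin n → ℕ
degMinus H Y v = count (λ u → adj H v u ∧ Data.Bool.not (mem Y u))
  where import Data.Bool

-- ē_H(X): number of edges of H with at least one end in X
-- (each edge {u,v} counted once, as the pair with toℕ u < toℕ v)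
ebar : ∀ {n} → Graph n → Subset n → ℕ
ebar H X = sumF (λ u → count (λ v →
  ⌊ toℕ u ℕ.<? toℕ v ⌋ ∧ adj H u v ∧ (mem X u ∨ mem X v)))

Disjoint : ∀ {n} → Subset n → Subset n → Set
Disjoint A B = ∀ x → x ∈ A → x ∈ B → ⊥

Nonempty : ∀ {n} → Subset n → Set
Nonempty A = ∃[ x ] x ∈ A

AdjSet : ∀ {n} → Graph n → Fin n → Subset n → Set
AdjSet H v X = ∃[ x ] (x ∈ X × Adj H v x)

ShadowConds : ∀ {n m} → ℕ → Graph n → (Fin m → Subset n) → Fin n → Subset n → Set
ShadowConds k H C w Y =
  (w ∈ Y)
  × (∀ i → (C i ⊆ Y) ⊎ Disjoint (C i) Y)
  × (∀ v → v ∉ Y → AdjSet H v Y → k ≤ degMinus H Y v)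
  × (∀ i → (∃[ x ] (x ∈ C i × AdjSet H x Y)) → C i ⊆ Y)

-- Y is the shadow sh_H(w): the unique inclusion-minimal set satisfying (I)-(IV).
-- (For finite families, "unique minimal" is the same as "least".)
IsShadow : ∀ {n m} → ℕ → Graph n → (Fin m → Subset n) → Fin n → Subset n → Set
IsShadow k H C w Y =
  ShadowConds k H C w Y × (∀ Y′ → ShadowConds k H C w Y′ → Y ⊆ Y′)

deficiency : ∀ {n} → ℕ → Graph n → Subset n → ℕ
deficiency k H Y = sumF (λ s →
  if mem Y s ∧ ⌊ deg H s ℕ.<? k ⌋ then k ∸ deg H s else 0)

module Submission where

-- Call Z excess bounded if def(Z) + ē(Z) ≤ (k−1)|Z| + 1, where def(Z) sums
-- k − deg(s) over the vertices s ∈ Z of degree < k.  The shadow Y = sh(w) is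
-- reached from {w} by greedily adding a vertex v that violates (III) (v ∉ Z is
-- adjacent to Z with fewer than k neighbours outside Z) or a whole class D that
-- violates (IV).  The set {w} is excess bounded since def + ē ≤ (k − deg w) + deg w = k,
-- and every step preserves the bound: a vertex v adds k − deg v to def and at most
-- deg_{H−Z}(v) edges, and these sum to at most k − 1 because v has a neighbour in Z;
-- a class D adds no deficiency and at most (k−1)|D| + 1 edges, one of which (an edge
-- joining D to Z) was counted already.  Every set met stays inside Y, so growth ends
-- at a set satisfying (I)–(IV), which is Y by minimality.  Finally ē(Y) < (k−1)|Y|
-- turns def + ē ≤ (k−1)|Y| + 1 into def ≤ 2((k−1)|Y| − ē).

open import Defs
open import Data.Nat using (ℕ; zero; suc; _+_; _*_; _∸_; _≤_; _<_; z≤n; s≤s)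
import Data.Nat as ℕ
open import Data.Nat.Properties
open import Data.Nat.Solver using (module +-*-Solver)
open +-*-Solver using (solve; _:+_; _:*_; _:=_; con)
open import Data.Bool using (Bool; true; false; T; not; _∧_; _∨_; if_then_else_)
open import Data.Bool.Properties using (T-≡; T-not-≡; T-∧; T-∨; ∨-commutativeMonoid)
import Data.Bool.Properties as Boolₚ
open import Data.Unit using (tt)
open import Data.Empty using (⊥; ⊥-elim)
open import Data.Fin using (Fin; zero; suc; toℕ)
import Data.Fin.Properties as Finₚ
open import Data.Fin.Subset using (Subset; _∈_; _∉_; _⊆_; _⊂_; ∣_∣; ⁅_⁆; _∪_)
open import Data.Fin.Subset.Properties
  using (x∈⁅x⁆; x∈⁅y⁆⇒x≡y; ∣⁅x⁆∣≡1; _∈?_; x∈p∪q⁻; p⊆p∪q; q⊆p∪q; ⊆-antisym; ∣p∣≤n; p⊂q⇒∣p∣<∣q∣)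
open import Data.Vec using (_∷_; []; here; there)
open import Data.Vec.Properties using (lookup-zipWith; []=⇒lookup; lookup⇒[]=)
open import Data.Product using (_×_; _,_; proj₁; proj₂; ∃-syntax)
open import Data.Sum using (_⊎_; inj₁; inj₂)
open import Function using (_∘_)
open import Function.Bundles using (Equivalence)
open import Relation.Binary.PropositionalEquality
open import Relation.Binary.Definitions using (tri<; tri≈; tri>)
open import Relation.Nullary using (¬_; ¬?; contradiction; Dec; yes; no)
open import Relation.Nullary.Decidable using (⌊_⌋; fromWitness; toWitness; _×-dec_)
open import Algebra.Bundles using (CommutativeMonoid)
open import Algebra.Properties.CommutativeSemigroup +-commutativeSemigroup
  using () renaming (interchange to +-interchange)
open import Algebra.Properties.CommutativeSemigroup
  (CommutativeMonoid.commutativeSemigroup ∨-commutativeMonoid)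
  using () renaming (interchange to ∨-interchange)

T-∧-intro : ∀ {b c} → T b → T c → T (b ∧ c)
T-∧-intro tb tc = Equivalence.from T-∧ (tb , tc)

T-∧-elim : ∀ b {c} → T (b ∧ c) → T b × T c
T-∧-elim b = Equivalence.to T-∧

T-∨-introˡ : ∀ {b} c → T b → T (b ∨ c)
T-∨-introˡ c tb = Equivalence.from T-∨ (inj₁ tb)

T-∨-introʳ : ∀ b {c} → T c → T (b ∨ c)
T-∨-introʳ b tc = Equivalence.from T-∨ (inj₂ tc)

T-∧-monoʳ : ∀ e {p q} → (T p → T q) → T (e ∧ p) → T (e ∧ q)
T-∧-monoʳ true h = h

T-guard : ∀ l e {p q} → (T p → T q) → T (l ∧ e ∧ p) → T (l ∧ e ∧ q)
T-guard l e = T-∧-monoʳ l ∘ T-∧-monoʳ e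

ind : Bool → ℕ
ind b = if b then 1 else 0

ind-mono : ∀ {b c} → (T b → T c) → ind b ≤ ind c
ind-mono {false} h = z≤n
ind-mono {true} {true} h = ≤-refl
ind-mono {true} {false} h = ⊥-elim (h tt)

ind-zero : ∀ {b} → ¬ T b → ind b ≡ 0
ind-zero {false} _ = refl
ind-zero {true} ¬t = contradiction tt ¬t

ind-pos : ∀ {b} → T b → 1 ≤ ind b
ind-pos {true} t = ≤-refl

sumF-cong : ∀ {n} (f g : Fin n → ℕ) → (∀ i → f i ≡ g i) → sumF f ≡ sumF g
sumF-cong {zero}  f g h = refl
sumF-cong {suc n} f g h = cong₂ _+_ (h zero) (sumF-cong (f ∘ suc) (g ∘ suc) (h ∘ suc))

sumF-mono : ∀ {n} (f g : Fin n → ℕ) → (∀ i → f i ≤ g i) → sumF f ≤ sumF g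
sumF-mono {zero}  f g h = z≤n
sumF-mono {suc n} f g h = +-mono-≤ (h zero) (sumF-mono (f ∘ suc) (g ∘ suc) (h ∘ suc))

sumF-+ : ∀ {n} (f g : Fin n → ℕ) → sumF (λ i → f i + g i) ≡ sumF f + sumF g
sumF-+ {zero}  f g = refl
sumF-+ {suc n} f g = trans (cong (f zero + g zero +_) (sumF-+ (f ∘ suc) (g ∘ suc)))
                           (+-interchange (f zero) (g zero) _ _)

sumF-zero : ∀ {n} (f : Fin n → ℕ) → (∀ i → f i ≡ 0) → sumF f ≡ 0
sumF-zero {zero}  f h = refl
sumF-zero {suc n} f h = cong₂ _+_ (h zero) (sumF-zero (f ∘ suc) (h ∘ suc))

sumF-term : ∀ {n} (f : Fin n → ℕ) i → f i ≤ sumF f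
sumF-term f zero    = m≤m+n _ _
sumF-term f (suc i) = ≤-trans (sumF-term (f ∘ suc) i) (m≤n+m _ (f zero))

sumF-single : ∀ {n} (f : Fin n → ℕ) v → (∀ i → i ≢ v → f i ≡ 0) → sumF f ≤ f v
sumF-single f zero h = ≤-reflexive (trans (cong (f zero +_) (sumF-zero (f ∘ suc) (λ i → h (suc i) λ ())))
                                          (+-identityʳ _))
sumF-single f (suc v) h rewrite h zero (λ ()) =
  sumF-single (f ∘ suc) v (λ i i≢v → h (suc i) (i≢v ∘ Finₚ.suc-injective))

count≡sumF : ∀ {n} (p : Fin n → Bool) → count p ≡ sumF (ind ∘ p)
count≡sumF {zero}  p = refl
count≡sumF {suc n} p = cong (ind (p zero) +_) (count≡sumF (p ∘ suc))

count-+ : ∀ {n} (p q : Fin n → Bool) → count p + count q ≡ sumF (λ i → ind (p i) + ind (q i))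
count-+ p q = trans (cong₂ _+_ (count≡sumF p) (count≡sumF q)) (sym (sumF-+ (ind ∘ p) (ind ∘ q)))

count-mono : ∀ {n} (p q : Fin n → Bool) → (∀ i → T (p i) → T (q i)) → count p ≤ count q
count-mono p q h = begin
  count p          ≡⟨ count≡sumF p ⟩
  sumF (ind ∘ p)   ≤⟨ sumF-mono _ _ (λ i → ind-mono (h i)) ⟩
  sumF (ind ∘ q)   ≡⟨ count≡sumF q ⟨
  count q          ∎
  where open ≤-Reasoning

count-pos : ∀ {n} (p : Fin n → Bool) i → T (p i) → 1 ≤ count p
count-pos p i t = ≤-trans (ind-pos t) (≤-trans (sumF-term (ind ∘ p) i) (≤-reflexive (sym (count≡sumF p))))

count-+-mono : ∀ {n} (p q r : Fin n → Bool) → (∀ i → ind (p i) + ind (q i) ≤ ind (r i))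
  → count p + count q ≤ count r
count-+-mono p q r h = begin
  count p + count q                   ≡⟨ count-+ p q ⟩
  sumF (λ i → ind (p i) + ind (q i))  ≤⟨ sumF-mono _ _ h ⟩
  sumF (ind ∘ r)                      ≡⟨ count≡sumF r ⟨
  count r                             ∎
  where open ≤-Reasoning

count-+-mono₂ : ∀ {n} (p q r s : Fin n → Bool) → (∀ i → ind (p i) + ind (q i) ≤ ind (r i) + ind (s i))
  → count p + count q ≤ count r + count s
count-+-mono₂ p q r s h = begin
  count p + count q                   ≡⟨ count-+ p q ⟩
  sumF (λ i → ind (p i) + ind (q i))  ≤⟨ sumF-mono _ _ h ⟩
  sumF (λ i → ind (r i) + ind (s i))  ≡⟨ count-+ r s ⟨
  count r + count s                   ∎
  where open ≤-Reasoning

∈⇒T : ∀ {n} {X : Subset n} {x} → x ∈ X → T (mem X x)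
∈⇒T x∈X = Equivalence.from T-≡ ([]=⇒lookup x∈X)

T⇒∈ : ∀ {n} {X : Subset n} {x} → T (mem X x) → x ∈ X
T⇒∈ {X = X} {x} t = lookup⇒[]= x X (Equivalence.to T-≡ t)

∉⇒false : ∀ {n} {X : Subset n} {x} → x ∉ X → mem X x ≡ false
∉⇒false {X = X} {x} x∉X with mem X x in eq
... | true  = ⊥-elim (x∉X (lookup⇒[]= x X eq))
... | false = refl

mem-∪ : ∀ {n} (A B : Subset n) x → mem (A ∪ B) x ≡ mem A x ∨ mem B x
mem-∪ A B x = lookup-zipWith _∨_ x A B

weight : ∀ {n} → (Fin n → ℕ) → Subset n → ℕ
weight g X = sumF (λ s → if mem X s then g s else 0)

weight-∪ : ∀ {n} (g : Fin n → ℕ) A B → weight g (A ∪ B) ≤ weight g A + weight g B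
weight-∪ g A B = begin
  weight g (A ∪ B)                                ≤⟨ sumF-mono _ _ pointwise ⟩
  sumF (λ s → gA s + gB s)                        ≡⟨ sumF-+ gA gB ⟩
  weight g A + weight g B                         ∎
  where
  open ≤-Reasoning
  gA gB : _ → ℕ
  gA s = if mem A s then g s else 0
  gB s = if mem B s then g s else 0
  split : ∀ a b x → (if a ∨ b then x else 0) ≤ (if a then x else 0) + (if b then x else 0)
  split true  b x = m≤m+n x _
  split false b x = ≤-refl
  pointwise : ∀ s → (if mem (A ∪ B) s then g s else 0) ≤ gA s + gB s
  pointwise s rewrite mem-∪ A B s = split (mem A s) (mem B s) (g s)

weight-vanish : ∀ {n} (g : Fin n → ℕ) X → (∀ s → s ∈ X → g s ≡ 0) → weight g X ≡ 0
weight-vanish g X h = sumF-zero _ pointwise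
  where
  pointwise : ∀ s → (if mem X s then g s else 0) ≡ 0
  pointwise s with mem X s in eq
  ... | true  = h s (lookup⇒[]= s X eq)
  ... | false = refl

weight-⁅⁆ : ∀ {n} (g : Fin n → ℕ) v → weight g ⁅ v ⁆ ≤ g v
weight-⁅⁆ g v = ≤-trans (sumF-single _ v off-v) (≤-reflexive at-v)
  where
  off-v : ∀ s → s ≢ v → (if mem ⁅ v ⁆ s then g s else 0) ≡ 0
  off-v s s≢v rewrite ∉⇒false (s≢v ∘ x∈⁅y⁆⇒x≡y v) = refl
  at-v : (if mem ⁅ v ⁆ v then g v else 0) ≡ g v
  at-v rewrite Equivalence.to T-≡ (∈⇒T (x∈⁅x⁆ v)) = refl

size-∪ : ∀ {n} (A B : Subset n) → Disjoint A B → ∣ A ∣ + ∣ B ∣ ≤ ∣ A ∪ B ∣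
size-∪ []          []          d = z≤n
size-∪ (true ∷ A)  (true ∷ B)  d = ⊥-elim (d zero here here)
size-∪ (true ∷ A)  (false ∷ B) d = s≤s (size-∪ A B (λ x a b → d (suc x) (there a) (there b)))
size-∪ (false ∷ A) (true ∷ B)  d = ≤-trans (≤-reflexive (+-suc ∣ A ∣ ∣ B ∣))
                                    (s≤s (size-∪ A B (λ x a b → d (suc x) (there a) (there b))))
size-∪ (false ∷ A) (false ∷ B) d = size-∪ A B (λ x a b → d (suc x) (there a) (there b))

gap : ∀ {n} → ℕ → Graph n → Fin n → ℕ
gap k H s = if ⌊ deg H s ℕ.<? k ⌋ then k ∸ deg H s else 0

deficiency≡weight : ∀ {n} k (H : Graph n) X → deficiency k H X ≡ weight (gap k H) X
deficiency≡weight k H X = sumF-cong _ _ pointwise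
  where
  pointwise : ∀ s → (if mem X s ∧ ⌊ deg H s ℕ.<? k ⌋ then k ∸ deg H s else 0)
                  ≡ (if mem X s then gap k H s else 0)
  pointwise s with mem X s
  ... | true  = refl
  ... | false = refl

deficiency-∪ : ∀ {n} k (H : Graph n) A B → deficiency k H (A ∪ B) ≤ deficiency k H A + deficiency k H B
deficiency-∪ k H A B rewrite deficiency≡weight k H (A ∪ B) | deficiency≡weight k H A | deficiency≡weight k H B =
  weight-∪ (gap k H) A B

deficiency-vanish : ∀ {n} k (H : Graph n) X → (∀ s → s ∈ X → k ≤ deg H s) → deficiency k H X ≡ 0
deficiency-vanish k H X h = trans (deficiency≡weight k H X) (weight-vanish (gap k H) X no-gap)
  where
  no-gap : ∀ s → s ∈ X → gap k H s ≡ 0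
  no-gap s s∈X with deg H s ℕ.<? k
  ... | yes d<k = contradiction (h s s∈X) (<⇒≱ d<k)
  ... | no  _   = refl

deficiency-⁅⁆ : ∀ {n} k (H : Graph n) v → deficiency k H ⁅ v ⁆ ≤ gap k H v
deficiency-⁅⁆ k H v = ≤-trans (≤-reflexive (deficiency≡weight k H ⁅ v ⁆)) (weight-⁅⁆ (gap k H) v)

gap-+-outside : ∀ {n} k (H : Graph n) v {μ} → μ < deg H v → μ < k → gap k H v + μ ≤ k ∸ 1
gap-+-outside k H v {μ} μ<d μ<k with deg H v ℕ.<? k
... | no  _   = <⇒≤pred μ<k
... | yes d<k = suc[m]≤n⇒m≤pred[n] (begin
    suc (k ∸ deg H v + μ)  ≡⟨ +-suc (k ∸ deg H v) μ ⟨
    k ∸ deg H v + suc μ    ≤⟨ +-monoʳ-≤ (k ∸ deg H v) μ<d ⟩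
    k ∸ deg H v + deg H v  ≡⟨ m∸n+n≡m (<⇒≤ d<k) ⟩
    k                      ∎)
  where open ≤-Reasoning

gap-+-deg : ∀ {n} k (H : Graph n) v → deg H v < k → gap k H v + deg H v ≡ k
gap-+-deg k H v d<k with deg H v ℕ.<? k
... | yes _   = m∸n+n≡m (<⇒≤ d<k)
... | no  d≮k = contradiction d<k d≮k

degMinus-anti : ∀ {n} (H : Graph n) {Z Y : Subset n} v → Z ⊆ Y → degMinus H Y v ≤ degMinus H Z v
degMinus-anti H {Z} {Y} v Z⊆Y = count-mono _ _ (λ u → T-∧-monoʳ (adj H v u) (outside-Z u))
  where
  outside-Z : ∀ u → T (not (mem Y u)) → T (not (mem Z u))
  outside-Z u t = Equivalence.from T-not-≡
    (∉⇒false (λ u∈Z → subst T (Equivalence.to T-not-≡ t) (∈⇒T (Z⊆Y u∈Z))))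

degMinus-<-deg : ∀ {n} (H : Graph n) (Z : Subset n) {v z} → z ∈ Z → Adj H v z → degMinus H Z v < deg H v
degMinus-<-deg H Z {v} {z} z∈Z vz = begin-strict
  degMinus H Z v                                          <⟨ ≤-refl ⟩
  1 + degMinus H Z v                                      ≤⟨ +-monoˡ-≤ _ inside ⟩
  count (λ u → adj H v u ∧ mem Z u) + degMinus H Z v      ≤⟨ count-+-mono _ _ _ (λ u → split (adj H v u) (mem Z u)) ⟩
  deg H v                                                 ∎
  where
  open ≤-Reasoning
  inside : 1 ≤ count (λ u → adj H v u ∧ mem Z u)
  inside = count-pos _ z (T-∧-intro (Equivalence.from T-≡ vz) (∈⇒T z∈Z))
  split : ∀ a s → ind (a ∧ s) + ind (a ∧ not s) ≤ ind a
  split false s     = z≤n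
  split true  true  = ≤-refl
  split true  false = ≤-refl

-- `lt` orients pairs as in the definition of ē; `edges H P` counts the
-- edges {a,b} (a before b) satisfying P, so that ebar H X = edges H (touches X).
lt : ∀ {n} → Fin n → Fin n → Bool
lt a b = ⌊ toℕ a ℕ.<? toℕ b ⌋

edges : ∀ {n} → Graph n → (Fin n → Fin n → Bool) → ℕ
edges H P = sumF (λ a → count (λ b → lt a b ∧ adj H a b ∧ P a b))

touches : ∀ {n} → Subset n → Fin n → Fin n → Bool
touches X a b = mem X a ∨ mem X b

touches-∪ : ∀ {n} (A B : Subset n) a b → touches (A ∪ B) a b ≡ touches A a b ∨ touches B a b
touches-∪ A B a b = trans (cong₂ _∨_ (mem-∪ A B a) (mem-∪ A B b))
                          (∨-interchange (mem A a) (mem B a) (mem A b) (mem B b))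

edges-mono : ∀ {n} (H : Graph n) (P Q : Fin n → Fin n → Bool)
  → (∀ a b → T (P a b) → T (Q a b)) → edges H P ≤ edges H Q
edges-mono H P Q h = sumF-mono _ _ (λ a → count-mono _ _ (λ b → T-guard (lt a b) (adj H a b) (h a b)))

edges-∨-∧ : ∀ {n} (H : Graph n) (P Q : Fin n → Fin n → Bool)
  → edges H (λ a b → P a b ∨ Q a b) + edges H (λ a b → P a b ∧ Q a b) ≤ edges H P + edges H Q
edges-∨-∧ H P Q = begin
  edges H P∨Q + edges H P∧Q                        ≡⟨ sumF-+ (count ∘ E P∨Q) (count ∘ E P∧Q) ⟨
  sumF (λ a → count (E P∨Q a) + count (E P∧Q a))   ≤⟨ sumF-mono _ _ per-row ⟩
  sumF (λ a → count (E P a) + count (E Q a))       ≡⟨ sumF-+ (count ∘ E P) (count ∘ E Q) ⟩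
  edges H P + edges H Q                            ∎
  where
  open ≤-Reasoning
  P∨Q P∧Q : _ → _ → Bool
  P∨Q a b = P a b ∨ Q a b
  P∧Q a b = P a b ∧ Q a b
  E : (_ → _ → Bool) → _ → _ → Bool
  E R a b = lt a b ∧ adj H a b ∧ R a b
  ind-∨-∧ : ∀ l e p q → ind (l ∧ e ∧ (p ∨ q)) + ind (l ∧ e ∧ (p ∧ q)) ≤ ind (l ∧ e ∧ p) + ind (l ∧ e ∧ q)
  ind-∨-∧ true  true  true  q     = ≤-refl
  ind-∨-∧ true  true  false true  = ≤-refl
  ind-∨-∧ true  true  false false = ≤-refl
  ind-∨-∧ true  false p     q     = ≤-refl
  ind-∨-∧ false e     p     q     = ≤-refl
  per-row : ∀ a → count (E P∨Q a) + count (E P∧Q a) ≤ count (E P a) + count (E Q a)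
  per-row a = count-+-mono₂ _ _ _ _ (λ b → ind-∨-∧ (lt a b) (adj H a b) (P a b) (Q a b))

edge-counted : ∀ {n} (H : Graph n) (P : Fin n → Fin n → Bool) a b
  → toℕ a < toℕ b → Adj H a b → T (P a b) → 1 ≤ edges H P
edge-counted H P a b a<b ab pab =
  ≤-trans (count-pos (λ b → lt a b ∧ adj H a b ∧ P a b) b
                     (T-∧-intro (fromWitness {a? = toℕ a ℕ.<? toℕ b} a<b)
                                (T-∧-intro (Equivalence.from T-≡ ab) pab)))
          (sumF-term (λ a → count (λ b → lt a b ∧ adj H a b ∧ P a b)) a)

edges-pos : ∀ {n} (H : Graph n) (P : Fin n → Fin n → Bool) {x z}
  → Adj H x z → T (P x z) → T (P z x) → 1 ≤ edges H P
edges-pos H P {x} {z} xz pxz pzx with <-cmp (toℕ x) (toℕ z)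
... | tri< x<z _ _ = edge-counted H P x z x<z xz pxz
... | tri> _ _ z<x = edge-counted H P z x z<x (trans (symm H z x) xz) pzx
... | tri≈ _ x≡z _ with Finₚ.toℕ-injective x≡z
...   | refl = contradiction (trans (sym (irrefl H x)) xz) λ ()

lt-asym : ∀ {n} {a b : Fin n} → T (lt a b) → T (lt b a) → ⊥
lt-asym ab ba = <-asym (toWitness ab) (toWitness ba)

star : ∀ {n} → Fin n → (Fin n → Bool) → Fin n → Fin n → Bool
star v q a b = (mem ⁅ v ⁆ a ∧ q b) ∨ (mem ⁅ v ⁆ b ∧ q a)

edges-star-out : ∀ {n} (H : Graph n) (v : Fin n) (q : Fin n → Bool)
  → edges H (λ a b → mem ⁅ v ⁆ a ∧ q b) ≤ count (λ u → lt v u ∧ adj H v u ∧ q u)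
edges-star-out H v q = ≤-trans (sumF-single _ v off-v)
  (count-mono _ _ (λ u → T-guard (lt v u) (adj H v u) (proj₂ ∘ T-∧-elim (mem ⁅ v ⁆ v))))
  where
  off-v : ∀ a → a ≢ v → count (λ b → lt a b ∧ adj H a b ∧ (mem ⁅ v ⁆ a ∧ q b)) ≡ 0
  off-v a a≢v = trans (count≡sumF (λ b → lt a b ∧ adj H a b ∧ (mem ⁅ v ⁆ a ∧ q b))) (sumF-zero _ (λ b →
    ind-zero (a≢v ∘ x∈⁅y⁆⇒x≡y v ∘ T⇒∈ ∘ at-a (lt a b) (adj H a b) (mem ⁅ v ⁆ a))))
    where
    at-a : ∀ l e m {r} → T (l ∧ e ∧ (m ∧ r)) → T m
    at-a true true m = proj₁ ∘ T-∧-elim m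

edges-star-in : ∀ {n} (H : Graph n) (v : Fin n) (q : Fin n → Bool)
  → edges H (λ a b → mem ⁅ v ⁆ b ∧ q a) ≤ count (λ u → lt u v ∧ adj H v u ∧ q u)
edges-star-in H v q = begin
  edges H (λ a b → mem ⁅ v ⁆ b ∧ q a)         ≤⟨ sumF-mono _ _ row ⟩
  sumF (λ u → ind (lt u v ∧ adj H v u ∧ q u))  ≡⟨ count≡sumF (λ u → lt u v ∧ adj H v u ∧ q u) ⟨
  count (λ u → lt u v ∧ adj H v u ∧ q u)       ∎
  where
  open ≤-Reasoning
  towards-v : ∀ a b → T (lt a b ∧ adj H a b ∧ (mem ⁅ v ⁆ b ∧ q a)) → b ≡ v × T (lt a v ∧ adj H v a ∧ q a)
  towards-v a b t with T-∧-elim (lt a b) t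
  ... | l , rest with T-∧-elim (adj H a b) rest
  ...   | e , rest′ with T-∧-elim (mem ⁅ v ⁆ b) rest′
  ...     | m , qa with x∈⁅y⁆⇒x≡y {x = b} v (T⇒∈ m)
  ...       | refl = refl , T-∧-intro l (T-∧-intro (subst T (symm H a b) e) qa)
  row : ∀ a → count (λ b → lt a b ∧ adj H a b ∧ (mem ⁅ v ⁆ b ∧ q a)) ≤ ind (lt a v ∧ adj H v a ∧ q a)
  row a = begin
    count (λ b → lt a b ∧ adj H a b ∧ (mem ⁅ v ⁆ b ∧ q a))
      ≡⟨ count≡sumF (λ b → lt a b ∧ adj H a b ∧ (mem ⁅ v ⁆ b ∧ q a)) ⟩
    sumF (λ b → ind (lt a b ∧ adj H a b ∧ (mem ⁅ v ⁆ b ∧ q a)))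
      ≤⟨ sumF-single _ v (λ b b≢v → ind-zero (b≢v ∘ proj₁ ∘ towards-v a b)) ⟩
    ind (lt a v ∧ adj H a v ∧ (mem ⁅ v ⁆ v ∧ q a))   ≤⟨ ind-mono (proj₂ ∘ towards-v a v) ⟩
    ind (lt a v ∧ adj H v a ∧ q a)                   ∎

edges-star : ∀ {n} (H : Graph n) (v : Fin n) (q : Fin n → Bool)
  → edges H (star v q) ≤ count (λ u → adj H v u ∧ q u)
edges-star H v q = begin
  edges H (star v q)                                      ≤⟨ m+n≤o⇒m≤o _ (edges-∨-∧ H out in′) ⟩
  edges H out + edges H in′                               ≤⟨ +-mono-≤ (edges-star-out H v q) (edges-star-in H v q) ⟩
  count (λ u → lt v u ∧ adj H v u ∧ q u) + count (λ u → lt u v ∧ adj H v u ∧ q u)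
      ≤⟨ count-+-mono _ _ _ (λ u → exclusive (lt v u) (lt u v) (adj H v u ∧ q u) lt-asym) ⟩
  count (λ u → adj H v u ∧ q u)                           ∎
  where
  open ≤-Reasoning
  out in′ : _ → _ → Bool
  out a b = mem ⁅ v ⁆ a ∧ q b
  in′ a b = mem ⁅ v ⁆ b ∧ q a
  exclusive : ∀ x y r → (T x → T y → ⊥) → ind (x ∧ r) + ind (y ∧ r) ≤ ind r
  exclusive false y     r h = ind-mono (proj₂ ∘ T-∧-elim y)
  exclusive true  false r h = ≤-reflexive (+-identityʳ (ind r))
  exclusive true  true  r h = contradiction tt (h tt)

-- An edge joining B to A is counted in both ē(A) and ē(B) but once in ē(A ∪ B).
ebar-∪-edge : ∀ {n} (H : Graph n) (A B : Subset n) {x z}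
  → Adj H x z → x ∈ B → z ∈ A → ebar H (A ∪ B) + 1 ≤ ebar H A + ebar H B
ebar-∪-edge H A B {x} {z} xz x∈B z∈A = begin
  ebar H (A ∪ B) + 1                             ≤⟨ +-mono-≤ union-split shared ⟩
  edges H tA∨tB + edges H tA∧tB                  ≤⟨ edges-∨-∧ H (touches A) (touches B) ⟩
  ebar H A + ebar H B                            ∎
  where
  open ≤-Reasoning
  tA∨tB tA∧tB : _ → _ → Bool
  tA∨tB a b = touches A a b ∨ touches B a b
  tA∧tB a b = touches A a b ∧ touches B a b
  union-split : ebar H (A ∪ B) ≤ edges H tA∨tB
  union-split = edges-mono H _ _ (λ a b → subst T (touches-∪ A B a b))
  shared : 1 ≤ edges H tA∧tB
  shared = edges-pos H tA∧tB xz
    (T-∧-intro (T-∨-introʳ (mem A x) (∈⇒T z∈A)) (T-∨-introˡ (mem B z) (∈⇒T x∈B)))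
    (T-∧-intro (T-∨-introˡ (mem A x) (∈⇒T z∈A)) (T-∨-introʳ (mem B z) (∈⇒T x∈B)))

ebar-∪-vertex : ∀ {n} (H : Graph n) (A : Subset n) v → ebar H (A ∪ ⁅ v ⁆) ≤ ebar H A + degMinus H A v
ebar-∪-vertex H A v = begin
  ebar H (A ∪ ⁅ v ⁆)                 ≤⟨ edges-mono H _ _ new-edges ⟩
  edges H (λ a b → touches A a b ∨ outward a b)
                                     ≤⟨ m+n≤o⇒m≤o _ (edges-∨-∧ H (touches A) outward) ⟩
  ebar H A + edges H outward         ≤⟨ +-monoʳ-≤ (ebar H A) (edges-star H v (not ∘ mem A)) ⟩
  ebar H A + degMinus H A v          ∎
  where
  open ≤-Reasoning
  outward : _ → _ → Bool
  outward = star v (not ∘ mem A)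
  split : ∀ p q r s → T ((p ∨ q) ∨ (r ∨ s)) → T ((p ∨ q) ∨ ((r ∧ not q) ∨ (s ∧ not p)))
  split true  q     r     s     t = tt
  split false true  r     s     t = tt
  split false false true  s     t = tt
  split false false false true  t = tt
  new-edges : ∀ a b → T (touches (A ∪ ⁅ v ⁆) a b) → T (touches A a b ∨ outward a b)
  new-edges a b = split (mem A a) (mem A b) (mem ⁅ v ⁆ a) (mem ⁅ v ⁆ b) ∘ subst T (touches-∪ A ⁅ v ⁆ a b)

ebar-⁅⁆ : ∀ {n} (H : Graph n) v → ebar H ⁅ v ⁆ ≤ deg H v
ebar-⁅⁆ H v = begin
  ebar H ⁅ v ⁆                         ≤⟨ edges-mono H _ _ (λ a b → at-v (mem ⁅ v ⁆ a) (mem ⁅ v ⁆ b)) ⟩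
  edges H (star v (λ _ → true))       ≤⟨ edges-star H v (λ _ → true) ⟩
  count (λ u → adj H v u ∧ true)      ≤⟨ count-mono _ _ (λ u → proj₁ ∘ T-∧-elim (adj H v u)) ⟩
  deg H v                             ∎
  where
  open ≤-Reasoning
  at-v : ∀ r s → T (r ∨ s) → T ((r ∧ true) ∨ (s ∧ true))
  at-v true  s    t = tt
  at-v false true t = tt

excess-extend : ∀ {a z s z′ d e d′ e′} → d + e ≤ a * z + 1 → d′ + e′ ≤ (d + e) + a * s → z + s ≤ z′
  → d′ + e′ ≤ a * z′ + 1
excess-extend {a} {z} {s} {z′} {d} {e} {d′} {e′} bound step room = begin
  d′ + e′              ≤⟨ step ⟩
  (d + e) + a * s      ≤⟨ +-monoˡ-≤ (a * s) bound ⟩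
  (a * z + 1) + a * s  ≡⟨ solve 3 (λ a z s → (a :* z :+ con 1) :+ a :* s := a :* (z :+ s) :+ con 1) refl a z s ⟩
  a * (z + s) + 1      ≤⟨ +-monoˡ-≤ 1 (*-monoʳ-≤ a room) ⟩
  a * z′ + 1           ∎
  where open ≤-Reasoning

-- Adding a class: the deficiency does not grow and at least one of its
-- ≤ a s + 1 edges was already counted.
class-increase : ∀ {a s d e eD d′ e′} → d′ ≤ d → e′ + 1 ≤ e + eD → eD ≤ a * s + 1
  → d′ + e′ ≤ (d + e) + a * s
class-increase {a} {s} {d} {e} {eD} {d′} {e′} dd ee eD≤ = +-cancelʳ-≤ 1 _ _ (begin
  (d′ + e′) + 1        ≡⟨ +-assoc d′ e′ 1 ⟩
  d′ + (e′ + 1)        ≤⟨ +-mono-≤ dd ee ⟩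
  d + (e + eD)         ≤⟨ +-monoʳ-≤ d (+-monoʳ-≤ e eD≤) ⟩
  d + (e + (a * s + 1)) ≡⟨ solve 3 (λ d e x → d :+ (e :+ (x :+ con 1)) := (d :+ e :+ x) :+ con 1) refl d e (a * s) ⟩
  (d + e + a * s) + 1  ∎)
  where open ≤-Reasoning

vertex-increase : ∀ {a s d e g μ d′ e′} → d′ ≤ d + g → e′ ≤ e + μ → g + μ ≤ a * s
  → d′ + e′ ≤ (d + e) + a * s
vertex-increase {a} {s} {d} {e} {g} {μ} dd ee gμ = begin
  _                    ≤⟨ +-mono-≤ dd ee ⟩
  (d + g) + (e + μ)    ≡⟨ +-interchange d g e μ ⟩
  (d + e) + (g + μ)    ≤⟨ +-monoʳ-≤ (d + e) gμ ⟩
  (d + e) + a * s      ∎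
  where open ≤-Reasoning

deficiency-from-excess : ∀ {d e A} → d + e ≤ A + 1 → e < A → d ≤ 2 * (A ∸ e)
deficiency-from-excess {d} {e} {A} bound e<A = begin
  d                    ≤⟨ +-cancelʳ-≤ e d _ (begin
                            d + e                 ≤⟨ bound ⟩
                            A + 1                 ≡⟨ cong (_+ 1) (m∸n+n≡m (<⇒≤ e<A)) ⟨
                            (A ∸ e + e) + 1       ≡⟨ solve 2 (λ x e → (x :+ e) :+ con 1 := (x :+ con 1) :+ e) refl (A ∸ e) e ⟩
                            (A ∸ e + 1) + e       ∎) ⟩
  A ∸ e + 1            ≤⟨ +-monoʳ-≤ (A ∸ e) (m<n⇒0<n∸m e<A) ⟩
  A ∸ e + (A ∸ e)      ≡⟨ cong (A ∸ e +_) (+-identityʳ (A ∸ e)) ⟨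
  2 * (A ∸ e)          ∎
  where open ≤-Reasoning

ExcessBounded : ∀ {n} → ℕ → Graph n → Subset n → Set
ExcessBounded k H Z = deficiency k H Z + ebar H Z ≤ (k ∸ 1) * ∣ Z ∣ + 1

∪-least : ∀ {n} {A B X : Subset n} → A ⊆ X → B ⊆ X → A ∪ B ⊆ X
∪-least {A = A} {B} A⊆X B⊆X u∈A∪B with x∈p∪q⁻ A B u∈A∪B
... | inj₁ u∈A = A⊆X u∈A
... | inj₂ u∈B = B⊆X u∈B

adjSet? : ∀ {n} (H : Graph n) v X → Dec (AdjSet H v X)
adjSet? H v X = Finₚ.any? (λ x → x ∈? X ×-dec adj H v x Boolₚ.≟ true)

-- The shadow of w is reached greedily from {w}: repeatedly add a vertex
-- that violates (III) or a whole class that violates (IV).  Every set met on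
-- the way lies inside the shadow Y, keeps classes whole, and is excess bounded.
module Growth (k : ℕ) {n} (H : Graph n) {m} (C : Fin m → Subset n)
  (classes-disjoint : ∀ i j → i ≢ j → Disjoint (C i) (C j))
  (class-sparse : ∀ i → ebar H (C i) ≤ (k ∸ 1) * ∣ C i ∣ + 1)
  (class-degree : ∀ i v → v ∈ C i → k ≤ deg H v)
  (w : Fin n) (Y : Subset n) (Y-shadow : IsShadow k H C w Y) where

  w∈Y : w ∈ Y
  w∈Y = proj₁ (proj₁ Y-shadow)

  Y-vertices : ∀ v → v ∉ Y → AdjSet H v Y → k ≤ degMinus H Y v
  Y-vertices = proj₁ (proj₂ (proj₂ (proj₁ Y-shadow)))

  Y-classes : ∀ i → (∃[ x ] (x ∈ C i × AdjSet H x Y)) → C i ⊆ Y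
  Y-classes = proj₂ (proj₂ (proj₂ (proj₁ Y-shadow)))

  Y-least : ∀ Z → ShadowConds k H C w Z → Y ⊆ Z
  Y-least = proj₂ Y-shadow

  record Partial (Z : Subset n) : Set where
    field
      within    : Z ⊆ Y
      has-w     : w ∈ Z
      saturated : ∀ j {x} → x ∈ C j → x ∈ Z → C j ⊆ Z
      bounded   : ExcessBounded k H Z

  Grows : Subset n → Set
  Grows Z = ∃[ Z′ ] (Partial Z′ × Z ⊂ Z′)

  bounded-∪ : ∀ {Z P} → ExcessBounded k H Z → Disjoint Z P
    → deficiency k H (Z ∪ P) + ebar H (Z ∪ P) ≤ (deficiency k H Z + ebar H Z) + (k ∸ 1) * ∣ P ∣
    → ExcessBounded k H (Z ∪ P)
  bounded-∪ {Z} {P} bZ disjoint cost =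
    excess-extend {a = k ∸ 1} {z = ∣ Z ∣} {s = ∣ P ∣} {d = deficiency k H Z} {e = ebar H Z}
                  {d′ = deficiency k H (Z ∪ P)} {e′ = ebar H (Z ∪ P)}
                  bZ cost (size-∪ Z P disjoint)

  -- A class D with a vertex adjacent to Z and a vertex outside Z can be added:
  -- it is disjoint from Z, lies in Y by (IV), and costs at most (k−1)|D|.
  grow-by-class : ∀ {Z} → Partial Z → ∀ j {x z y} → x ∈ C j → z ∈ Z → Adj H x z → y ∈ C j → y ∉ Z → Grows Z
  grow-by-class {Z} PZ j {x} {z} {y} x∈D z∈Z xz y∈D y∉Z =
    Z ∪ D , partial , (p⊆p∪q D , y , q⊆p∪q Z D y∈D , y∉Z)
    where
    open Partial PZ
    D : Subset n
    D = C j
    disjoint : Disjoint Z D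
    disjoint u u∈Z u∈D = y∉Z (saturated j u∈D u∈Z y∈D)
    saturated′ : ∀ i {u} → u ∈ C i → u ∈ Z ∪ D → C i ⊆ Z ∪ D
    saturated′ i u∈Ci u∈Z∪D with x∈p∪q⁻ Z D u∈Z∪D
    ... | inj₁ u∈Z = λ v∈Ci → p⊆p∪q D (saturated i u∈Ci u∈Z v∈Ci)
    ... | inj₂ u∈D with i Finₚ.≟ j
    ...   | yes refl = q⊆p∪q Z D
    ...   | no  i≢j  = ⊥-elim (classes-disjoint i j i≢j _ u∈Ci u∈D)
    no-new-deficiency : deficiency k H (Z ∪ D) ≤ deficiency k H Z
    no-new-deficiency = ≤-trans (deficiency-∪ k H Z D)
      (≤-reflexive (trans (cong (deficiency k H Z +_) (deficiency-vanish k H D (class-degree j)))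
                          (+-identityʳ _)))
    partial : Partial (Z ∪ D)
    partial = record
      { within    = ∪-least within (Y-classes j (x , x∈D , z , within z∈Z , xz))
      ; has-w     = p⊆p∪q D has-w
      ; saturated = saturated′
      ; bounded   = bounded-∪ bounded disjoint
          (class-increase {a = k ∸ 1} {s = ∣ D ∣} {d = deficiency k H Z} {e = ebar H Z}
                          no-new-deficiency (ebar-∪-edge H Z D xz x∈D z∈Z) (class-sparse j))
      }

  -- A vertex v ∉ Z in no class, adjacent to Z and with fewer than k neighbours
  -- outside Z, can be added: it lies in Y by (III) and costs at most k − 1.
  grow-by-vertex : ∀ {Z} → Partial Z → ∀ {v z} → v ∉ Z → z ∈ Z → Adj H v z → degMinus H Z v < k
    → (∀ j → v ∉ C j) → Grows Z
  grow-by-vertex {Z} PZ {v} {z} v∉Z z∈Z vz few-outside no-class =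
    Z ∪ ⁅ v ⁆ , partial , (p⊆p∪q ⁅ v ⁆ , v , q⊆p∪q Z ⁅ v ⁆ (x∈⁅x⁆ v) , v∉Z)
    where
    open Partial PZ
    -- Otherwise condition (III) for Y would give degMinus H Z v ≥ degMinus H Y v ≥ k.
    v∈Y : v ∈ Y
    v∈Y with v ∈? Y
    ... | yes v∈Y = v∈Y
    ... | no  v∉Y = contradiction (≤-trans (Y-vertices v v∉Y (z , within z∈Z , vz)) (degMinus-anti H v within))
                                  (<⇒≱ few-outside)
    disjoint : Disjoint Z ⁅ v ⁆
    disjoint u u∈Z u∈⁅v⁆ = v∉Z (subst (_∈ Z) (x∈⁅y⁆⇒x≡y v u∈⁅v⁆) u∈Z)
    saturated′ : ∀ i {u} → u ∈ C i → u ∈ Z ∪ ⁅ v ⁆ → C i ⊆ Z ∪ ⁅ v ⁆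
    saturated′ i u∈Ci u∈Z∪v with x∈p∪q⁻ Z ⁅ v ⁆ u∈Z∪v
    ... | inj₁ u∈Z   = λ w∈Ci → p⊆p∪q ⁅ v ⁆ (saturated i u∈Ci u∈Z w∈Ci)
    ... | inj₂ u∈⁅v⁆ = ⊥-elim (no-class i (subst (_∈ C i) (x∈⁅y⁆⇒x≡y v u∈⁅v⁆) u∈Ci))
    cost : gap k H v + degMinus H Z v ≤ (k ∸ 1) * ∣ ⁅ v ⁆ ∣
    cost = ≤-trans (gap-+-outside k H v (degMinus-<-deg H Z z∈Z vz) few-outside)
                   (≤-reflexive (sym (trans (cong ((k ∸ 1) *_) (∣⁅x⁆∣≡1 v)) (*-identityʳ (k ∸ 1)))))
    partial : Partial (Z ∪ ⁅ v ⁆)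
    partial = record
      { within    = ∪-least within (λ u∈⁅v⁆ → subst (_∈ Y) (sym (x∈⁅y⁆⇒x≡y v u∈⁅v⁆)) v∈Y)
      ; has-w     = p⊆p∪q ⁅ v ⁆ has-w
      ; saturated = saturated′
      ; bounded   = bounded-∪ bounded disjoint
          (vertex-increase {a = k ∸ 1} {s = ∣ ⁅ v ⁆ ∣} {d = deficiency k H Z} {e = ebar H Z}
                           {g = gap k H v} {μ = degMinus H Z v}
                           (≤-trans (deficiency-∪ k H Z ⁅ v ⁆) (+-monoʳ-≤ (deficiency k H Z) (deficiency-⁅⁆ k H v)))
                           (ebar-∪-vertex H Z v) cost)
      }

  Addable : Subset n → Fin n → Set
  Addable Z v = v ∉ Z × AdjSet H v Z × degMinus H Z v < k

  Pending : Subset n → Fin m → Set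
  Pending Z j = (∃[ x ] (x ∈ C j × AdjSet H x Z)) × (∃[ y ] (y ∈ C j × y ∉ Z))

  addable? : ∀ Z v → Dec (Addable Z v)
  addable? Z v = ¬? (v ∈? Z) ×-dec adjSet? H v Z ×-dec degMinus H Z v ℕ.<? k

  pending? : ∀ Z j → Dec (Pending Z j)
  pending? Z j = Finₚ.any? (λ x → x ∈? C j ×-dec adjSet? H x Z)
          ×-dec Finₚ.any? (λ y → y ∈? C j ×-dec ¬? (y ∈? Z))

  closed : ∀ {Z} → Partial Z → ¬ (∃[ v ] Addable Z v) → ¬ (∃[ j ] Pending Z j) → ShadowConds k H C w Z
  closed {Z} PZ no-vertex no-class = has-w , whole-or-disjoint , vertices , classes
    where
    open Partial PZ
    whole-or-disjoint : ∀ i → (C i ⊆ Z) ⊎ Disjoint (C i) Z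
    whole-or-disjoint i with Finₚ.any? (λ x → x ∈? C i ×-dec x ∈? Z)
    ... | yes (x , x∈Ci , x∈Z) = inj₁ (saturated i x∈Ci x∈Z)
    ... | no  none             = inj₂ (λ x x∈Ci x∈Z → none (x , x∈Ci , x∈Z))
    vertices : ∀ v → v ∉ Z → AdjSet H v Z → k ≤ degMinus H Z v
    vertices v v∉Z v~Z = ≮⇒≥ (λ few → no-vertex (v , v∉Z , v~Z , few))
    classes : ∀ i → (∃[ x ] (x ∈ C i × AdjSet H x Z)) → C i ⊆ Z
    classes i Ci~Z {y} y∈Ci with y ∈? Z
    ... | yes y∈Z = y∈Z
    ... | no  y∉Z = ⊥-elim (no-class (i , Ci~Z , y , y∈Ci , y∉Z))

  grow-or-closed : ∀ {Z} → Partial Z → Grows Z ⊎ ShadowConds k H C w Z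
  grow-or-closed {Z} PZ with Finₚ.any? (addable? Z)
  ... | yes (v , v∉Z , (z , z∈Z , vz) , few) with Finₚ.any? (λ j → v ∈? C j)
  ...   | yes (j , v∈Cj) = inj₁ (grow-by-class PZ j v∈Cj z∈Z vz v∈Cj v∉Z)
  ...   | no  no-class   = inj₁ (grow-by-vertex PZ v∉Z z∈Z vz few (λ j v∈Cj → no-class (j , v∈Cj)))
  grow-or-closed {Z} PZ | no no-vertex with Finₚ.any? (pending? Z)
  ... | yes (j , (x , x∈D , z , z∈Z , xz) , y , y∈D , y∉Z) = inj₁ (grow-by-class PZ j x∈D z∈Z xz y∈D y∉Z)
  ... | no  no-class = inj₂ (closed PZ no-vertex no-class)

  -- Growing a stage Z reaches Y, which is therefore excess bounded.  Each step
  -- enlarges Z and |Z| ≤ n, so n − |Z| more steps (the fuel) suffice.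
  grow-to-Y : ∀ fuel {Z} → Partial Z → n ≤ ∣ Z ∣ + fuel → ExcessBounded k H Y
  grow-to-Y fuel {Z} PZ room with grow-or-closed PZ
  ... | inj₂ Z-closed = subst (ExcessBounded k H) (⊆-antisym (Partial.within PZ) (Y-least Z Z-closed))
                              (Partial.bounded PZ)
  grow-to-Y zero {Z} PZ room | inj₁ (Z′ , _ , Z⊂Z′) =
    contradiction (∣p∣≤n Z′) (<⇒≱ (≤-<-trans (≤-trans room (≤-reflexive (+-identityʳ ∣ Z ∣))) (p⊂q⇒∣p∣<∣q∣ Z⊂Z′)))
  grow-to-Y (suc fuel) {Z} PZ room | inj₁ (Z′ , PZ′ , Z⊂Z′) =
    grow-to-Y fuel PZ′ (≤-trans room (≤-trans (≤-reflexive (+-suc ∣ Z ∣ fuel)) (+-monoˡ-≤ fuel (p⊂q⇒∣p∣<∣q∣ Z⊂Z′))))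

  -- The growth starts from {w}, which is excess bounded as w has degree < k.
  start : 1 ≤ k → deg H w < k → Partial ⁅ w ⁆
  start 1≤k w-low = record
    { within    = λ u∈⁅w⁆ → subst (_∈ Y) (sym (x∈⁅y⁆⇒x≡y w u∈⁅w⁆)) w∈Y
    ; has-w     = x∈⁅x⁆ w
    ; saturated = λ j u∈Cj u∈⁅w⁆ →
        contradiction (class-degree j _ (subst (_∈ C j) (x∈⁅y⁆⇒x≡y w u∈⁅w⁆) u∈Cj)) (<⇒≱ w-low)
    ; bounded   = begin
        deficiency k H ⁅ w ⁆ + ebar H ⁅ w ⁆  ≤⟨ +-mono-≤ (deficiency-⁅⁆ k H w) (ebar-⁅⁆ H w) ⟩
        gap k H w + deg H w                 ≡⟨ gap-+-deg k H w w-low ⟩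
        k                                   ≡⟨ m∸n+n≡m 1≤k ⟨
        (k ∸ 1) + 1                         ≡⟨ cong (_+ 1) (*-identityʳ (k ∸ 1)) ⟨
        (k ∸ 1) * 1 + 1                     ≡⟨ cong (λ s → (k ∸ 1) * s + 1) (∣⁅x⁆∣≡1 w) ⟨
        (k ∸ 1) * ∣ ⁅ w ⁆ ∣ + 1             ∎
    }
    where open ≤-Reasoning

corollary4p12 : (k : ℕ) → 2 ≤ k → {n : ℕ} → (H : Graph n)
    → {m : ℕ} → (C : Fin m → Subset n)
    → (∀ i → Nonempty (C i))
    → (∀ i j → i ≢ j → Disjoint (C i) (C j))
    → (∀ i → ebar H (C i) ≤ (k ∸ 1) * ∣ C i ∣ + 1)
    → (∀ i → ∀ v → v ∈ C i → k ≤ deg H v)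
    → (w : Fin n) → deg H w ≤ k ∸ 1
    → (Y : Subset n) → IsShadow k H C w Y
    → ebar H Y < (k ∸ 1) * ∣ Y ∣
    → deficiency k H Y ≤ 2 * ((k ∸ 1) * ∣ Y ∣ ∸ ebar H Y)
corollary4p12 k 2≤k {n} H C _ classes-disjoint class-sparse class-degree w w-low Y Y-shadow sparse-Y =
  deficiency-from-excess Y-bounded sparse-Y
  where
  open Growth k H C classes-disjoint class-sparse class-degree w Y Y-shadow
  1≤k : 1 ≤ k
  1≤k = ≤-trans (s≤s z≤n) 2≤k
  w-below-k : deg H w < k
  w-below-k = ≤-<-trans w-low (∸-monoʳ-< {k} {1} {0} ≤-refl 1≤k)
  Y-bounded : ExcessBounded k H Y
  Y-bounded = grow-to-Y n (start 1≤k w-below-k) (m≤n+m n ∣ ⁅ w ⁆ ∣)
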